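{- Let $\mathbf A$ be a connexive Heyting algebra. For every $a\in A$: $\neg\neg a=a$ if and only if $a\rightarrow b\le b\rightarrow a$ for every $b\in A$.
   Context: A connexive Heyting algebra is an algebra $\langle A,\wedge,\vee,\rightarrow,0,1\rangle$ whose $\{\wedge,\vee,0,1\}$-reduct is a bounded distributive lattice with lattice order $\le$, satisfying, with $\neg x:=x\rightarrow0$: (C1) $(x\rightarrow y)\rightarrow((y\rightarrow z)\rightarrow(x\rightarrow z))=1$; (C2) $(x\rightarrow y)\rightarrow\neg(x\rightarrow\neg y)=1$; (C3) $x\wedge(x\rightarrow y)=x\wedge y$; (C4) $x\rightarrow y\le(z\wedge x)\rightarrow(z\wedge y)$; (C5) $x\rightarrow y\le(z\vee x)\rightarrow(z\vee y)$. -}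

module Defs where

open import Level using (suc; _⊔_)
open import Relation.Binary.Core using (Rel)
open import Algebra.Core using (Op₂)
open import Algebra.Definitions using (Congruent₂)
open import Algebra.Lattice.Structures using (IsDistributiveLattice)

record ConnexiveHeytingAlgebra c ℓ : Set (suc (c ⊔ ℓ)) where
  infixr 7 _∧_
  infixr 6 _∨_
  infixr 5 _⇒_
  infix  4 _≈_ _≤_
  field
    Carrier               : Set c
    _≈_                   : Rel Carrier ℓ
    _∨_                   : Op₂ Carrier
    _∧_                   : Op₂ Carrier
    _⇒_                   : Op₂ Carrier
    ⊥ᴬ                    : Carrier
    ⊤ᴬ                    : Carrier
    isDistributiveLattice : IsDistributiveLattice _≈_ _∨_ _∧_
    ⇒-cong                : Congruent₂ _≈_ _⇒_

  _≤_ : Rel Carrier ℓ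
  x ≤ y = (x ∧ y) ≈ x

  ¬_ : Carrier → Carrier
  ¬ x = x ⇒ ⊥ᴬ

  field
    ⊥-least    : ∀ x → ⊥ᴬ ≤ x
    ⊤-greatest : ∀ x → x ≤ ⊤ᴬ
    C1 : ∀ x y z → ((x ⇒ y) ⇒ ((y ⇒ z) ⇒ (x ⇒ z))) ≈ ⊤ᴬ
    C2 : ∀ x y → ((x ⇒ y) ⇒ (¬ (x ⇒ (¬ y)))) ≈ ⊤ᴬ
    C3 : ∀ x y → (x ∧ (x ⇒ y)) ≈ (x ∧ y)
    C4 : ∀ x y z → (x ⇒ y) ≤ ((z ∧ x) ⇒ (z ∧ y))
    C5 : ∀ x y z → (x ⇒ y) ≤ ((z ∨ x) ⇒ (z ∨ y))

  open IsDistributiveLattice isDistributiveLattice public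

{-# OPTIONS --safe #-}
module Submission where

-- The heart of the argument is an introduction rule for the connexive
-- implication: p ≤ x ⇒ y as soon as p ∧ x ≤ y and p ∧ ¬ x ≤ ¬ y, i.e. an
-- implication holds when it is validated both positively and on negations.
-- If ¬ ¬ a = a, then a ⇒ b validates b ⇒ a in this sense: negatively by
-- contraposition, positively because b ∧ ¬ a would validate a ⇒ ¬ b, which
-- Boethius' thesis (C2) forbids below a ⇒ b.  Conversely, Boethius' thesis
-- with antecedent 1 gives a ⇒ ¬ ¬ a = 1, so the hypothesis for b = ¬ ¬ a
-- yields ¬ ¬ a ⇒ a = 1, that is ¬ ¬ a ≤ a.

open import Level using (Level)
open import Data.Product using (_×_; _,_)
open import Algebra.Lattice.Bundles using (Lattice)
open import Algebra.Lattice.Properties.Lattice using (∨-∧-orderTheoreticLattice)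
open import Relation.Binary.Bundles using (Poset)
import Relation.Binary.Lattice as OrderLattice
open import Defs

module ConnexiveHeytingAlgebraProperties
  {c ℓ : Level} (A : ConnexiveHeytingAlgebra c ℓ) where

  open ConnexiveHeytingAlgebra A

  -- The library orders a lattice by x ≈ x ∧ y; ours is the same relation with
  -- the sides of ≈ swapped.
  private
    lattice : Lattice c ℓ
    lattice = record { isLattice = isLattice }

    module Natural = OrderLattice.Lattice (∨-∧-orderTheoreticLattice lattice)

  ≤-isLattice : OrderLattice.IsLattice _≈_ _≤_ _∨_ _∧_
  ≤-isLattice = record
    { isPartialOrder = record
      { isPreorder = record
        { isEquivalence = isEquivalence
        ; reflexive     = λ x≈y → sym (Natural.reflexive x≈y)
        ; trans         = λ x≤y y≤z → sym (Natural.trans (sym x≤y) (sym y≤z))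
        }
      ; antisym = λ x≤y y≤x → Natural.antisym (sym x≤y) (sym y≤x)
      }
    ; supremum = λ x y → let x≤ , y≤ , least = Natural.supremum x y in
        sym x≤ , sym y≤ , λ z x≤z y≤z → sym (least z (sym x≤z) (sym y≤z))
    ; infimum = λ x y → let ≤x , ≤y , greatest = Natural.infimum x y in
        sym ≤x , sym ≤y , λ z z≤x z≤y → sym (greatest z (sym z≤x) (sym z≤y))
    }

  ≤-poset : Poset c ℓ ℓ
  ≤-poset = record
    { isPartialOrder = OrderLattice.IsLattice.isPartialOrder ≤-isLattice }

  open OrderLattice.IsLattice ≤-isLattice
    using (x∧y≤x; x∧y≤y; ∧-greatest; x≤x∨y; y≤x∨y; ∨-least)
    renaming (refl to ≤-refl; trans to ≤-trans; antisym to ≤-antisym;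
              reflexive to ≤-reflexive)
  open import Relation.Binary.Reasoning.PartialOrder ≤-poset

  ⊤∧x≈x : ∀ x → ⊤ᴬ ∧ x ≈ x
  ⊤∧x≈x x = trans (∧-comm ⊤ᴬ x) (⊤-greatest x)

  x∧⊥≈⊥ : ∀ x → x ∧ ⊥ᴬ ≈ ⊥ᴬ
  x∧⊥≈⊥ x = trans (∧-comm x ⊥ᴬ) (⊥-least x)

  x≤⊥⇒x≈⊥ : ∀ {x} → x ≤ ⊥ᴬ → x ≈ ⊥ᴬ
  x≤⊥⇒x≈⊥ {x} x≤⊥ = ≤-antisym x≤⊥ (⊥-least x)

  ⊤≤x⇒x≈⊤ : ∀ {x} → ⊤ᴬ ≤ x → x ≈ ⊤ᴬ
  ⊤≤x⇒x≈⊤ {x} ⊤≤x = ≤-antisym (⊤-greatest x) ⊤≤x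

  ⊤⇒x≈x : ∀ x → ⊤ᴬ ⇒ x ≈ x
  ⊤⇒x≈x x = begin-equality
    ⊤ᴬ ⇒ x             ≈⟨ ⊤∧x≈x (⊤ᴬ ⇒ x) ⟨
    ⊤ᴬ ∧ (⊤ᴬ ⇒ x)      ≈⟨ C3 ⊤ᴬ x ⟩
    ⊤ᴬ ∧ x             ≈⟨ ⊤∧x≈x x ⟩
    x                  ∎

  x⇒y≈⊤⇒x≤y : ∀ {x y} → x ⇒ y ≈ ⊤ᴬ → x ≤ y
  x⇒y≈⊤⇒x≤y {x} {y} x⇒y≈⊤ = begin
    x                  ≈⟨ ⊤-greatest x ⟨
    x ∧ ⊤ᴬ             ≈⟨ ∧-congˡ x⇒y≈⊤ ⟨
    x ∧ (x ⇒ y)        ≈⟨ C3 x y ⟩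
    x ∧ y              ≤⟨ x∧y≤y x y ⟩
    y                  ∎

  modus-ponens : ∀ x y → x ∧ (x ⇒ y) ≤ y
  modus-ponens x y = ≤-trans (≤-reflexive (C3 x y)) (x∧y≤y x y)

  ⇒-∧-restrict : ∀ {x y z x′ y′} → z ∧ x ≈ x′ → z ∧ y ≈ y′ →
                 x ⇒ y ≤ x′ ⇒ y′
  ⇒-∧-restrict {x} {y} {z} z∧x≈x′ z∧y≈y′ =
    ≤-trans (C4 x y z) (≤-reflexive (⇒-cong z∧x≈x′ z∧y≈y′))

  ⇒-trans-≤ : ∀ {p x y z} → p ≤ x ⇒ y → p ≤ y ⇒ z → p ≤ x ⇒ z
  ⇒-trans-≤ {p} {x} {y} {z} p≤x⇒y p≤y⇒z = begin
    p                                  ≤⟨ ∧-greatest p≤y⇒z (≤-trans p≤x⇒y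
                                            (x⇒y≈⊤⇒x≤y (C1 x y z))) ⟩
    (y ⇒ z) ∧ ((y ⇒ z) ⇒ (x ⇒ z))      ≤⟨ modus-ponens (y ⇒ z) (x ⇒ z) ⟩
    x ⇒ z                              ∎

  ⇒-contrapose : ∀ x y → x ⇒ y ≤ ¬ y ⇒ ¬ x
  ⇒-contrapose x y = x⇒y≈⊤⇒x≤y (C1 x y ⊥ᴬ)

  x≤y⇒[y∧x] : ∀ x y → x ≤ y ⇒ (y ∧ x)
  x≤y⇒[y∧x] x y = begin
    x                  ≈⟨ ⊤⇒x≈x x ⟨
    ⊤ᴬ ⇒ x             ≤⟨ ⇒-∧-restrict (⊤-greatest y) refl ⟩
    y ⇒ (y ∧ x)        ∎

  x≤x⇒⊤ : ∀ x → x ≤ x ⇒ ⊤ᴬ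
  x≤x⇒⊤ x = trans (C3 x ⊤ᴬ) (⊤-greatest x)

  x∧¬x≈⊥ : ∀ x → x ∧ ¬ x ≈ ⊥ᴬ
  x∧¬x≈⊥ x = trans (C3 x ⊥ᴬ) (x∧⊥≈⊥ x)

  x∧y≈⊥⇒x≤¬y : ∀ {x y} → x ∧ y ≈ ⊥ᴬ → x ≤ ¬ y
  x∧y≈⊥⇒x≤¬y {x} {y} x∧y≈⊥ = begin
    x                  ≤⟨ x≤y⇒[y∧x] x y ⟩
    y ⇒ (y ∧ x)        ≈⟨ ⇒-cong refl (trans (∧-comm y x) x∧y≈⊥) ⟩
    ¬ y                ∎

  x≤y⇒x≤¬y⇒x≈⊥ : ∀ {x y} → x ≤ y → x ≤ ¬ y → x ≈ ⊥ᴬ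
  x≤y⇒x≤¬y⇒x≈⊥ {x} {y} x≤y x≤¬y = x≤⊥⇒x≈⊥ (begin
    x                  ≤⟨ ∧-greatest x≤y x≤¬y ⟩
    y ∧ ¬ y            ≈⟨ x∧¬x≈⊥ y ⟩
    ⊥ᴬ                 ∎)

  ¬-antitone : ∀ {x y} → x ≤ y → ¬ y ≤ ¬ x
  ¬-antitone {x} {y} x≤y = x∧y≈⊥⇒x≤¬y
    (x≤y⇒x≤¬y⇒x≈⊥ (≤-trans (x∧y≤y (¬ y) x) x≤y) (x∧y≤x (¬ y) x))

  ¬x∧¬y≤¬[x∨y] : ∀ x y → ¬ x ∧ ¬ y ≤ ¬ (x ∨ y)
  ¬x∧¬y≤¬[x∨y] x y = x∧y≈⊥⇒x≤¬y (x≤⊥⇒x≈⊥ (begin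
    (¬ x ∧ ¬ y) ∧ (x ∨ y)                  ≈⟨ ∧-distribˡ-∨ (¬ x ∧ ¬ y) x y ⟩
    ((¬ x ∧ ¬ y) ∧ x) ∨ ((¬ x ∧ ¬ y) ∧ y)  ≤⟨ ∨-least (disjoint (x∧y≤x _ _))
                                                      (disjoint (x∧y≤y _ _)) ⟩
    ⊥ᴬ                                     ∎))
    where
    disjoint : ∀ {m z} → m ≤ ¬ z → m ∧ z ≤ ⊥ᴬ
    disjoint {m} {z} m≤¬z = ≤-reflexive
      (x≤y⇒x≤¬y⇒x≈⊥ (x∧y≤y m z) (≤-trans (x∧y≤x m z) m≤¬z))

  x≤¬¬x : ∀ x → x ≤ ¬ ¬ x
  x≤¬¬x x = x∧y≈⊥⇒x≤¬y (x∧¬x≈⊥ x)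

  x⇒¬¬x≈⊤ : ∀ x → x ⇒ ¬ ¬ x ≈ ⊤ᴬ
  x⇒¬¬x≈⊤ x = begin-equality
    x ⇒ ¬ ¬ x                    ≈⟨ ⇒-cong (⊤⇒x≈x x) (⇒-cong (⊤⇒x≈x (¬ x)) refl) ⟨
    (⊤ᴬ ⇒ x) ⇒ ¬ (⊤ᴬ ⇒ ¬ x)      ≈⟨ C2 ⊤ᴬ x ⟩
    ⊤ᴬ                           ∎

  ¬¬x⇒y≤x⇒y : ∀ x y → ¬ ¬ x ⇒ y ≤ x ⇒ y
  ¬¬x⇒y≤x⇒y x y = ⇒-trans-≤
    (≤-trans (⊤-greatest (¬ ¬ x ⇒ y)) (≤-reflexive (sym (x⇒¬¬x≈⊤ x)))) ≤-refl

  ¬⊥≈⊤ : ¬ ⊥ᴬ ≈ ⊤ᴬ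
  ¬⊥≈⊤ = ⊤≤x⇒x≈⊤ (x∧y≈⊥⇒x≤¬y (x∧⊥≈⊥ ⊤ᴬ))

  ¬x≤⊥⇒x : ∀ x → ¬ x ≤ ⊥ᴬ ⇒ x
  ¬x≤⊥⇒x x = begin
    ¬ x                ≤⟨ x≤x⇒⊤ (¬ x) ⟩
    ¬ x ⇒ ⊤ᴬ           ≤⟨ ⇒-∧-restrict (x∧¬x≈⊥ x) (⊤-greatest x) ⟩
    ⊥ᴬ ⇒ x             ∎

  ¬¬x≤x⇒⊤ : ∀ x → ¬ ¬ x ≤ x ⇒ ⊤ᴬ
  ¬¬x≤x⇒⊤ x = begin
    ¬ ¬ x              ≤⟨ ¬x≤⊥⇒x (¬ x) ⟩
    ⊥ᴬ ⇒ ¬ x           ≤⟨ ⇒-contrapose ⊥ᴬ (¬ x) ⟩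
    ¬ ¬ x ⇒ ¬ ⊥ᴬ       ≈⟨ ⇒-cong refl ¬⊥≈⊤ ⟩
    ¬ ¬ x ⇒ ⊤ᴬ         ≤⟨ ¬¬x⇒y≤x⇒y x ⊤ᴬ ⟩
    x ⇒ ⊤ᴬ             ∎

  ¬¬[x∨¬y]≤x⇒y : ∀ {x y} → x ≤ y → ¬ ¬ (x ∨ ¬ y) ≤ x ⇒ y
  ¬¬[x∨¬y]≤x⇒y {x} {y} x≤y = begin
    ¬ ¬ (x ∨ ¬ y)      ≤⟨ ¬¬x≤x⇒⊤ (x ∨ ¬ y) ⟩
    (x ∨ ¬ y) ⇒ ⊤ᴬ     ≤⟨ ⇒-∧-restrict y∧[x∨¬y]≈x (⊤-greatest y) ⟩
    x ⇒ y              ∎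
    where
    y∧[x∨¬y]≈x : y ∧ (x ∨ ¬ y) ≈ x
    y∧[x∨¬y]≈x = begin-equality
      y ∧ (x ∨ ¬ y)            ≈⟨ ∧-distribˡ-∨ y x (¬ y) ⟩
      (y ∧ x) ∨ (y ∧ ¬ y)      ≈⟨ ∨-cong (trans (∧-comm y x) x≤y) (x∧¬x≈⊥ y) ⟩
      x ∨ ⊥ᴬ                   ≈⟨ ∨-congˡ (x∧⊥≈⊥ x) ⟨
      x ∨ (x ∧ ⊥ᴬ)             ≈⟨ ∨-absorbs-∧ x ⊥ᴬ ⟩
      x                        ∎

  ⇒-intro-≤ : ∀ {p x y} → x ≤ y → p ∧ ¬ x ≤ ¬ y → p ≤ x ⇒ y
  ⇒-intro-≤ {p} {x} {y} x≤y p∧¬x≤¬y =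
    ≤-trans (x∧y≈⊥⇒x≤¬y p∧¬[x∨¬y]≈⊥) (¬¬[x∨¬y]≤x⇒y x≤y)
    where
    p∧¬[x∨¬y]≈⊥ : p ∧ ¬ (x ∨ ¬ y) ≈ ⊥ᴬ
    p∧¬[x∨¬y]≈⊥ = x≤y⇒x≤¬y⇒x≈⊥
      (≤-trans (∧-greatest (x∧y≤x _ _)
                 (≤-trans (x∧y≤y _ _) (¬-antitone (x≤x∨y x (¬ y)))))
               p∧¬x≤¬y)
      (≤-trans (x∧y≤y _ _) (¬-antitone (y≤x∨y x (¬ y))))

  -- Routed through x ∨ y and its part (x ∨ y) ∧ p below y, where the
  -- antecedent lies below the consequent and ⇒-intro-≤ applies.
  ⇒-intro : ∀ {p x y} → p ∧ x ≤ y → p ∧ ¬ x ≤ ¬ y → p ≤ x ⇒ y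
  ⇒-intro {p} {x} {y} p∧x≤y p∧¬x≤¬y =
    ⇒-trans-≤ p≤x⇒x∨y (⇒-trans-≤ (x≤y⇒[y∧x] p (x ∨ y)) p≤w⇒y)
    where
    w = (x ∨ y) ∧ p

    p≤x⇒x∨y : p ≤ x ⇒ (x ∨ y)
    p≤x⇒x∨y = ⇒-intro-≤ (x≤x∨y x y) (begin
      p ∧ ¬ x          ≤⟨ ∧-greatest (x∧y≤y p (¬ x)) p∧¬x≤¬y ⟩
      ¬ x ∧ ¬ y        ≤⟨ ¬x∧¬y≤¬[x∨y] x y ⟩
      ¬ (x ∨ y)        ∎)

    w≤y : w ≤ y
    w≤y = begin
      (x ∨ y) ∧ p          ≈⟨ ∧-comm (x ∨ y) p ⟩
      p ∧ (x ∨ y)          ≈⟨ ∧-distribˡ-∨ p x y ⟩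
      (p ∧ x) ∨ (p ∧ y)    ≤⟨ ∨-least p∧x≤y (x∧y≤y p y) ⟩
      y                    ∎

    p≤w⇒y : p ≤ w ⇒ y
    p≤w⇒y = ⇒-intro-≤ w≤y (x∧y≈⊥⇒x≤¬y (x≤y⇒x≤¬y⇒x≈⊥ {y = w}
      (∧-greatest (≤-trans (x∧y≤y _ y) (y≤x∨y x y))
                  (≤-trans (x∧y≤x _ y) (x∧y≤x p _)))
      (≤-trans (x∧y≤x _ y) (x∧y≤y p _))))

  x∧y≤x⇒y : ∀ x y → x ∧ y ≤ x ⇒ y
  x∧y≤x⇒y x y = ⇒-intro
    (≤-trans (x∧y≤x _ x) (x∧y≤y x y))
    (≤-trans (≤-reflexive (x≤y⇒x≤¬y⇒x≈⊥ (≤-trans (x∧y≤x _ (¬ x)) (x∧y≤x x y))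
                                         (x∧y≤y _ (¬ x))))
             (⊥-least (¬ y)))

  ¬¬a≈a⇒a⇒b≤b⇒a : ∀ {a} → ¬ ¬ a ≈ a → ∀ b → a ⇒ b ≤ b ⇒ a
  ¬¬a≈a⇒a⇒b≤b⇒a {a} ¬¬a≈a b = ⇒-intro p∧b≤a p∧¬b≤¬a
    where
    p = a ⇒ b

    p∧¬b≤¬a : p ∧ ¬ b ≤ ¬ a
    p∧¬b≤¬a = begin
      p ∧ ¬ b                  ≤⟨ ∧-greatest (x∧y≤y p (¬ b))
                                    (≤-trans (x∧y≤x p (¬ b)) (⇒-contrapose a b)) ⟩
      ¬ b ∧ (¬ b ⇒ ¬ a)        ≤⟨ modus-ponens (¬ b) (¬ a) ⟩
      ¬ a                      ∎

    p∧b∧¬a≤a⇒¬b : (p ∧ b) ∧ ¬ a ≤ a ⇒ ¬ b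
    p∧b∧¬a≤a⇒¬b = begin
      (p ∧ b) ∧ ¬ a            ≤⟨ ∧-greatest (≤-trans (x∧y≤x (p ∧ b) (¬ a))
                                                      (x∧y≤y p b))
                                             (x∧y≤y (p ∧ b) (¬ a)) ⟩
      b ∧ ¬ a                  ≤⟨ x∧y≤x⇒y b (¬ a) ⟩
      b ⇒ ¬ a                  ≤⟨ ⇒-contrapose b (¬ a) ⟩
      ¬ ¬ a ⇒ ¬ b              ≈⟨ ⇒-cong ¬¬a≈a refl ⟩
      a ⇒ ¬ b                  ∎

    p∧b≤a : p ∧ b ≤ a
    p∧b≤a = begin
      p ∧ b                    ≤⟨ x∧y≈⊥⇒x≤¬y (x≤y⇒x≤¬y⇒x≈⊥ p∧b∧¬a≤a⇒¬b
               (≤-trans (≤-trans (x∧y≤x (p ∧ b) (¬ a)) (x∧y≤x p b))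
                        (x⇒y≈⊤⇒x≤y (C2 a b)))) ⟩
      ¬ ¬ a                    ≈⟨ ¬¬a≈a ⟩
      a                        ∎

  a⇒b≤b⇒a⇒¬¬a≈a : ∀ {a} → (∀ b → a ⇒ b ≤ b ⇒ a) → ¬ ¬ a ≈ a
  a⇒b≤b⇒a⇒¬¬a≈a {a} a⇒b≤b⇒a = ≤-antisym (x⇒y≈⊤⇒x≤y ¬¬a⇒a≈⊤) (x≤¬¬x a)
    where
    ¬¬a⇒a≈⊤ : ¬ ¬ a ⇒ a ≈ ⊤ᴬ
    ¬¬a⇒a≈⊤ = ⊤≤x⇒x≈⊤ (begin
      ⊤ᴬ               ≈⟨ x⇒¬¬x≈⊤ a ⟨
      a ⇒ ¬ ¬ a        ≤⟨ a⇒b≤b⇒a (¬ ¬ a) ⟩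
      ¬ ¬ a ⇒ a        ∎)

open ConnexiveHeytingAlgebraProperties

lemma3p16 : ∀ {c ℓ : Level} (A : ConnexiveHeytingAlgebra c ℓ) →
    let open ConnexiveHeytingAlgebra A in
    ∀ (a : Carrier) →
      ((¬ (¬ a)) ≈ a → ∀ (b : Carrier) → (a ⇒ b) ≤ (b ⇒ a))
      × ((∀ (b : Carrier) → (a ⇒ b) ≤ (b ⇒ a)) → (¬ (¬ a)) ≈ a)
lemma3p16 A a = ¬¬a≈a⇒a⇒b≤b⇒a A , a⇒b≤b⇒a⇒¬¬a≈a A
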